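{- Let $G=(V,E)$ be a finite graph with $V=\{v_1,\ldots,v_{|V|}\}$ and $E=\{e_1,\ldots,e_{|E|}\}$, and let $q\in\mathbb{Z}_+$. Index binary vectors by pairs $(v,e)\in V\times E$ and define $$\widetilde{\mathcal{I}}_X=\Big\{\mathbf{x}\in\{0,1\}^{V\times E}:\ \sum_{v\in V}x_{v,e}\le 1\ \ \forall e\in E\Big\},$$ $$\widetilde{\mathcal{I}}_Y(\mathbf{x})=\Big\{\mathbf{y}\in\{0,1\}^{V\times E}:\ \mathbf{y}\le \mathbf{1}-\mathbf{x},\ \sum_{e\in E}y_{v,e}\le 1\ \ \forall v\in V\Big\},$$ and the weight vector $\widetilde{\boldsymbol\beta}\in\{0,1\}^{V\times E}$ by $\widetilde\beta_{v,e}=1$ if the edge $e$ is incident to the vertex $v$ and $\widetilde\beta_{v,e}=0$ otherwise. Let $\widetilde q=|V|-q$. Then $G$ has an independent set $S\subseteq V$ (no two vertices of $S$ adjacent) with $|S|\ge q$ if and only if there exists $\mathbf{x}\in\widetilde{\mathcal{I}}_X$ such that $$\max_{\mathbf{y}\in\widetilde{\mathcal{I}}_Y(\mathbf{x})}\widetilde{\boldsymbol\beta}^\top\mathbf{y}\le \widetilde q.$$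
   Context: This is the reduction from the decision version of the maximum independent set problem to the decision version of the partition matroid interdiction problem: the leader's feasible set $\widetilde{\mathcal I}_X$ is a partition matroid with groups $L_k=\{(v,e_k):v\in V\}$ and capacities $1$, and the follower's feasible set is a partition matroid with groups $F_k=\{(v_k,e):e\in E\}$ and capacities $1$, with the leader's chosen elements removed. -}

module Defs where

open import Data.Nat using (ℕ; zero; suc; _+_; _≤_)
open import Data.Bool using (Bool; true; false; if_then_else_)
open import Data.Fin using (Fin; zero; suc)
open import Data.Fin.Subset using (Subset; _∈_)
open import Data.Product using (_×_; _,_; proj₁; proj₂)
open import Data.Sum using (_⊎_)
open import Relation.Binary.PropositionalEquality using (_≡_; _≢_)
open import Relation.Nullary using (¬_)
open import Data.Fin using (_≟_)
open import Relation.Nullary.Decidable using (⌊_⌋)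

sumFin : (k : ℕ) → (Fin k → ℕ) → ℕ
sumFin zero    f = 0
sumFin (suc k) f = f zero + sumFin k (λ i → f (suc i))

bit : Bool → ℕ
bit true  = 1
bit false = 0

record Graph (n m : ℕ) : Set where
  field
    ends      : Fin m → Fin n × Fin n
    loopless  : ∀ k → proj₁ (ends k) ≢ proj₂ (ends k)
    simple    : ∀ k l → (ends k ≡ ends l ⊎ ends k ≡ (proj₂ (ends l) , proj₁ (ends l))) → k ≡ l
open Graph public

BinVec : ℕ → ℕ → Set
BinVec n m = Fin n → Fin m → Bool

module _ {n m : ℕ} (G : Graph n m) where

  Incident : Fin n → Fin m → Set
  Incident v e = v ≡ proj₁ (ends G e) ⊎ v ≡ proj₂ (ends G e)

  Adjacent : Fin n → Fin n → Set
  Adjacent u v = Data.Product.Σ (Fin m) λ e →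
    (ends G e ≡ (u , v)) ⊎ (ends G e ≡ (v , u))

  IndependentSet : Subset n → Set
  IndependentSet S = ∀ u v → u ∈ S → v ∈ S → ¬ Adjacent u v

  β̃ : Fin n → Fin m → ℕ
  β̃ v e = bit (⌊ v ≟ proj₁ (ends G e) ⌋ Data.Bool.∨ ⌊ v ≟ proj₂ (ends G e) ⌋)

  weight : BinVec n m → ℕ
  weight y = sumFin n λ v → sumFin m λ e → β̃ v e Data.Nat.* bit (y v e)

InIX : {n m : ℕ} → BinVec n m → Set
InIX {n} {m} x = ∀ (e : Fin m) → sumFin n (λ v → bit (x v e)) ≤ 1

InIY : {n m : ℕ} → BinVec n m → BinVec n m → Set
InIY {n} {m} x y =
  (∀ v e → bit (y v e) ≤ 1 Data.Nat.∸ bit (x v e)) ×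
  (∀ (v : Fin n) → sumFin m (λ e → bit (y v e)) ≤ 1)

module Submission where

-- Read x v e = true as "edge e is interdicted at its endpoint v": each edge may be interdicted
-- at one end only, and the follower's best response scores one for every vertex having an
-- incident edge that is not interdicted there (it takes one such edge per vertex).  Given an
-- independent set S, interdicting every edge at its endpoint in S leaves every vertex of S
-- scoreless, so the follower scores at most n − |S|.  Conversely, for any x the vertices all of
-- whose edges are interdicted at them form an independent set, as an edge joining two of them
-- would be interdicted twice, and the greedy response scores exactly n − |S| on it.  Per vertex
-- both facts read  load + [v ∈ S] ≤ 1  (resp. = 1), which sum over V to the two bounds.

open import Defs
open import Data.Nat using (ℕ; _≥_)
open import Data.Integer using (ℤ; +_; _-_) renaming (_≤_ to _≤ℤ_)
open import Data.Fin.Subset using (Subset; ∣_∣)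
open import Data.Product using (Σ; _×_)
open import Function.Bundles using (_⇔_)

open import Data.Bool using (Bool; true; false; not; _∧_; _∨_)
open import Data.Bool.Properties using (not-injective; ¬-not; ∧-zeroʳ; ∧-identityʳ)
open import Data.Fin using (Fin; zero; suc; _≟_)
open import Data.Fin.Properties using (0≢1+n; suc-injective)
open import Data.Fin.Subset using (_∈_)
open import Data.Integer using (+≤+; -_)
import Data.Integer.Properties as ℤ
open import Data.Nat using (zero; suc; _+_; _*_; _∸_; _≤_; z≤n; s≤s; _≤?_)
open import Data.Nat.Properties
  using (≤-refl; ≤-reflexive; ≤-trans; +-mono-≤; +-monoʳ-≤; +-identityʳ; +-cancelˡ-≤;
         m≤n+m; m+n≤o⇒n≤o; m+n≤o⇒m≤o∸n; m≤o∸n⇒m+n≤o; m∸n≡0⇒m≤n;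
         +-commutativeSemigroup; module ≤-Reasoning)
open import Algebra.Properties.CommutativeSemigroup +-commutativeSemigroup using (interchange)
open import Data.Product using (_,_; proj₁; proj₂)
open import Data.Sum using (_⊎_; inj₁; inj₂; [_,_]′)
open import Data.Vec using (_∷_; []; lookup; tabulate)
open import Data.Vec.Properties using (lookup∘tabulate; []=⇒lookup; lookup⇒[]=)
open import Function using (_∘_; id)
open import Function.Bundles using (mk⇔; Equivalence)
open import Relation.Binary.PropositionalEquality
open import Relation.Nullary using (Dec; yes; no; contradiction)
open import Relation.Nullary.Decidable using (⌊_⌋; _⊎-dec_; isYes≗does)

sumFin-cong : ∀ k {f g : Fin k → ℕ} → (∀ i → f i ≡ g i) → sumFin k f ≡ sumFin k g
sumFin-cong zero    f≗g = refl
sumFin-cong (suc k) f≗g = cong₂ _+_ (f≗g zero) (sumFin-cong k (f≗g ∘ suc))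

sumFin-mono : ∀ k {f g : Fin k → ℕ} → (∀ i → f i ≤ g i) → sumFin k f ≤ sumFin k g
sumFin-mono zero    f≤g = z≤n
sumFin-mono (suc k) f≤g = +-mono-≤ (f≤g zero) (sumFin-mono k (f≤g ∘ suc))

sumFin-+ : ∀ k (f g : Fin k → ℕ) → sumFin k (λ i → f i + g i) ≡ sumFin k f + sumFin k g
sumFin-+ zero    f g = refl
sumFin-+ (suc k) f g = trans (cong (_+_ (f zero + g zero)) (sumFin-+ k (f ∘ suc) (g ∘ suc)))
                             (interchange (f zero) (g zero) (sumFin k (f ∘ suc)) (sumFin k (g ∘ suc)))

sumFin≤size : ∀ k {f : Fin k → ℕ} → (∀ i → f i ≤ 1) → sumFin k f ≤ k
sumFin≤size zero    f≤1 = z≤n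
sumFin≤size (suc k) f≤1 = +-mono-≤ (f≤1 zero) (sumFin≤size k (f≤1 ∘ suc))

sumFin≡size : ∀ k {f : Fin k → ℕ} → (∀ i → f i ≡ 1) → sumFin k f ≡ k
sumFin≡size zero    f≡1 = refl
sumFin≡size (suc k) f≡1 = cong₂ _+_ (f≡1 zero) (sumFin≡size k (f≡1 ∘ suc))

count : (k : ℕ) → (Fin k → Bool) → ℕ
count k f = sumFin k (λ i → bit (f i))

count-lookup : ∀ {k} (p : Subset k) → count k (lookup p) ≡ ∣ p ∣
count-lookup []          = refl
count-lookup (true  ∷ p) = cong suc (count-lookup p)
count-lookup (false ∷ p) = count-lookup p

count-none : ∀ k {f : Fin k → Bool} → (∀ i → f i ≡ false) → count k f ≡ 0
count-none zero    none = refl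
count-none (suc k) none rewrite none zero = count-none k (none ∘ suc)

count≥1 : ∀ k {f : Fin k → Bool} i → f i ≡ true → 1 ≤ count k f
count≥1 (suc k)     zero    fi rewrite fi = s≤s z≤n
count≥1 (suc k) {f} (suc i) fi = ≤-trans (count≥1 k i fi) (m≤n+m _ (bit (f zero)))

count-mono : ∀ k {f g : Fin k → Bool} → (∀ i → f i ≡ true → g i ≡ true) → count k f ≤ count k g
count-mono k f⊆g = sumFin-mono k (λ i → bit-mono (f⊆g i))
  where
  bit-mono : ∀ {a b} → (a ≡ true → b ≡ true) → bit a ≤ bit b
  bit-mono {false} a⇒b = z≤n
  bit-mono {true}  a⇒b rewrite a⇒b refl = ≤-refl

count≤1 : ∀ k {f : Fin k → Bool} → (∀ i j → f i ≡ true → f j ≡ true → i ≡ j) → count k f ≤ 1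
count≤1 zero            unique = z≤n
count≤1 (suc k) {f} unique with f zero in f0
... | true  = ≤-reflexive (cong suc (count-none k (λ i → ¬-not (0≢1+n ∘ unique zero (suc i) f0))))
... | false = count≤1 k (λ i j fi fj → suc-injective (unique (suc i) (suc j) fi fj))

count≤1⇒unique : ∀ k {f : Fin k → Bool} → count k f ≤ 1 →
                 ∀ i j → f i ≡ true → f j ≡ true → i ≡ j
count≤1⇒unique (suc k)     ≤1 zero    zero    fi fj = refl
count≤1⇒unique (suc k)     ≤1 zero    (suc j) fi fj
  with s≤s () ← ≤-trans (+-mono-≤ (≤-reflexive (cong bit (sym fi))) (count≥1 k j fj)) ≤1
count≤1⇒unique (suc k)     ≤1 (suc i) zero    fi fj
  with s≤s () ← ≤-trans (+-mono-≤ (≤-reflexive (cong bit (sym fj))) (count≥1 k i fi)) ≤1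
count≤1⇒unique (suc k) {f} ≤1 (suc i) (suc j) fi fj =
  cong suc (count≤1⇒unique k (≤-trans (m≤n+m _ (bit (f zero))) ≤1) i j fi fj)

anyᵇ : ∀ k → (Fin k → Bool) → Bool
anyᵇ zero    f = false
anyᵇ (suc k) f = f zero ∨ anyᵇ k (f ∘ suc)

anyᵇ-false : ∀ k {f : Fin k → Bool} → anyᵇ k f ≡ false → ∀ i → f i ≡ false
anyᵇ-false (suc k) {f} none i with f zero in f0
anyᵇ-false (suc k) none zero    | false = f0
anyᵇ-false (suc k) none (suc i) | false = anyᵇ-false k none i

first : ∀ k → (Fin k → Bool) → Fin k → Bool
first (suc k) f zero    = f zero
first (suc k) f (suc i) = not (f zero) ∧ first k (f ∘ suc) i

first-⊆ : ∀ k {f : Fin k → Bool} i → first k f i ≡ true → f i ≡ true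
first-⊆ (suc k)     zero    fi = fi
first-⊆ (suc k) {f} (suc i) fi with f zero
... | false = first-⊆ k i fi

count-first : ∀ k (f : Fin k → Bool) → count k (first k f) ≡ bit (anyᵇ k f)
count-first zero    f = refl
count-first (suc k) f with f zero
... | true  = cong suc (count-none k (λ _ → refl))
... | false = count-first k (f ∘ suc)

+m≤+n-+o⇔m+o≤n : ∀ m n o → (+ m ≤ℤ + n - + o) ⇔ (m + o ≤ n)
+m≤+n-+o⇔m+o≤n m n o rewrite ℤ.m-n≡m⊖n n o with o ≤? n
... | yes o≤n rewrite ℤ.⊖-≥ o≤n =
  mk⇔ (m≤o∸n⇒m+n≤o m o≤n ∘ ℤ.drop‿+≤+) (+≤+ ∘ m+n≤o⇒m≤o∸n m)
... | no  o≰n rewrite ℤ.⊖-≰ o≰n =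
  mk⇔ (λ le → contradiction (m∸n≡0⇒m≤n (nonneg≤-⇒0 le)) o≰n)
      (λ le → contradiction (m+n≤o⇒n≤o m le) o≰n)
  where
  nonneg≤-⇒0 : ∀ {d} → + m ≤ℤ - + d → d ≡ 0
  nonneg≤-⇒0 {zero} _ = refl

bit-∧ : ∀ a b → bit a * bit b ≡ bit (a ∧ b)
bit-∧ false b = refl
bit-∧ true  b = +-identityʳ (bit b)

∧≡true⇒ : ∀ a {b} → a ∧ b ≡ true → a ≡ true × b ≡ true
∧≡true⇒ true b≡true = refl , b≡true

bit+bit-not : ∀ a → bit a + bit (not a) ≡ 1
bit+bit-not false = refl
bit+bit-not true  = refl

module _ {n m : ℕ} (G : Graph n m) where

  incident? : ∀ v e → Dec (Incident G v e)
  incident? v e = (v ≟ proj₁ (ends G e)) ⊎-dec (v ≟ proj₂ (ends G e))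

  β̃≡bit-incident? : ∀ v e → β̃ G v e ≡ bit ⌊ incident? v e ⌋
  β̃≡bit-incident? v e = cong bit (begin
    ⌊ v ≟ p ⌋ ∨ ⌊ v ≟ q ⌋                 ≡⟨ cong₂ _∨_ (isYes≗does (v ≟ p)) (isYes≗does (v ≟ q)) ⟩
    Dec.does ((v ≟ p) ⊎-dec (v ≟ q))     ≡⟨ isYes≗does ((v ≟ p) ⊎-dec (v ≟ q)) ⟨
    ⌊ incident? v e ⌋                     ∎)
    where
    open ≡-Reasoning
    p q : Fin n
    p = proj₁ (ends G e)
    q = proj₂ (ends G e)

  incident⇒≡⊎adjacent : ∀ {u v e} → Incident G u e → Incident G v e → u ≡ v ⊎ Adjacent G u v
  incident⇒≡⊎adjacent         (inj₁ refl) (inj₁ refl) = inj₁ refl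
  incident⇒≡⊎adjacent {e = e} (inj₁ refl) (inj₂ refl) = inj₂ (e , inj₁ refl)
  incident⇒≡⊎adjacent {e = e} (inj₂ refl) (inj₁ refl) = inj₂ (e , inj₂ refl)
  incident⇒≡⊎adjacent         (inj₂ refl) (inj₂ refl) = inj₁ refl

  adjacent⇒incident : ∀ {u v} (adj : Adjacent G u v) →
                      Incident G u (proj₁ adj) × Incident G v (proj₁ adj)
  adjacent⇒incident (e , inj₁ uv) = inj₁ (sym (cong proj₁ uv)) , inj₂ (sym (cong proj₂ uv))
  adjacent⇒incident (e , inj₂ vu) = inj₂ (sym (cong proj₂ vu)) , inj₁ (sym (cong proj₁ vu))

  adjacent⇒≢ : ∀ {u v} → Adjacent G u v → u ≢ v
  adjacent⇒≢ (e , inj₁ uv) refl = loopless G e (trans (cong proj₁ uv) (sym (cong proj₂ uv)))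
  adjacent⇒≢ (e , inj₂ vu) refl = loopless G e (trans (cong proj₁ vu) (sym (cong proj₂ vu)))

  load : BinVec n m → Fin n → ℕ
  load y v = sumFin m (λ e → β̃ G v e * bit (y v e))

  load≡count : ∀ y v → load y v ≡ count m (λ e → ⌊ incident? v e ⌋ ∧ y v e)
  load≡count y v = sumFin-cong m (λ e →
    trans (cong (_* bit (y v e)) (β̃≡bit-incident? v e)) (bit-∧ ⌊ incident? v e ⌋ (y v e)))

  weight+∣S∣ : ∀ y S → weight G y + ∣ S ∣ ≡ sumFin n (λ v → load y v + bit (lookup S v))
  weight+∣S∣ y S = trans (cong (_+_ (weight G y)) (sym (count-lookup S)))
                         (sym (sumFin-+ n (load y) (λ v → bit (lookup S v))))

  stars : Subset n → BinVec n m
  stars S v e = lookup S v ∧ ⌊ incident? v e ⌋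

  stars⇒∈×incident : ∀ {S v e} → stars S v e ≡ true → v ∈ S × Incident G v e
  stars⇒∈×incident {S} {v} {e} h with lookup S v in v∈S | incident? v e
  ... | true | yes i = lookup⇒[]= v S v∈S , i

  stars-feasible : ∀ {S} → IndependentSet G S → InIX (stars S)
  stars-feasible {S} indep e = count≤1 n same-endpoint
    where
    same-endpoint : ∀ u v → stars S u e ≡ true → stars S v e ≡ true → u ≡ v
    same-endpoint u v xu xv with stars⇒∈×incident xu | stars⇒∈×incident xv
    ... | u∈S , iu | v∈S , iv =
      [ id , (λ adj → contradiction adj (indep u v u∈S v∈S)) ]′ (incident⇒≡⊎adjacent iu iv)

  stars-load : ∀ S {y} → InIY (stars S) y → ∀ v → load y v + bit (lookup S v) ≤ 1
  stars-load S {y} (y≤1-x , y≤1) v with lookup S v in v∈S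
  ... | true  = ≤-reflexive (cong (_+ 1) (trans (load≡count y v)
                  (count-none m (λ e → blocked v∈S (incident? v e) (y v e) (y≤1-x v e)))))
    where
    blocked : ∀ {s P} → s ≡ true → (i : Dec P) → ∀ b →
              bit b ≤ 1 ∸ bit (s ∧ ⌊ i ⌋) → ⌊ i ⌋ ∧ b ≡ false
    blocked refl (no _)  b     _ = refl
    blocked refl (yes _) false _ = refl
  ... | false = begin
    load y v + 0                             ≡⟨ +-identityʳ (load y v) ⟩
    load y v                                 ≡⟨ load≡count y v ⟩
    count m (λ e → ⌊ incident? v e ⌋ ∧ y v e)
      ≤⟨ count-mono m (λ e → proj₂ ∘ ∧≡true⇒ ⌊ incident? v e ⌋) ⟩
    count m (y v)                            ≤⟨ y≤1 v ⟩
    1                                        ∎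
    where
    open ≤-Reasoning

  exposed : BinVec n m → Fin n → Fin m → Bool
  exposed x v e = ⌊ incident? v e ⌋ ∧ not (x v e)

  covered : BinVec n m → Subset n
  covered x = tabulate (λ v → not (anyᵇ m (exposed x v)))

  response : BinVec n m → BinVec n m
  response x v = first m (exposed x v)

  covered⇒blocked : ∀ {x v e} → v ∈ covered x → Incident G v e → x v e ≡ true
  covered⇒blocked {x} {v} {e} v∈C i = blocked (incident? v e) (anyᵇ-false m none e)
    where
    none : anyᵇ m (exposed x v) ≡ false
    none = not-injective (trans (sym (lookup∘tabulate _ v)) ([]=⇒lookup v∈C))
    blocked : (i? : Dec (Incident G v e)) → ⌊ i? ⌋ ∧ not (x v e) ≡ false → x v e ≡ true
    blocked (yes _) h = not-injective h
    blocked (no ¬i) _ = contradiction i ¬i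

  covered-independent : ∀ {x} → InIX x → IndependentSet G (covered x)
  covered-independent {x} x∈IX u v u∈C v∈C adj@(e , _) with adjacent⇒incident adj
  ... | iu , iv =
    adjacent⇒≢ adj (count≤1⇒unique n (x∈IX e) u v (covered⇒blocked u∈C iu) (covered⇒blocked v∈C iv))

  response⇒exposed : ∀ {x v e} → response x v e ≡ true → ⌊ incident? v e ⌋ ≡ true × x v e ≡ false
  response⇒exposed {x} {v} {e} r with ∧≡true⇒ ⌊ incident? v e ⌋ (first-⊆ m e r)
  ... | i , not-x = i , not-injective not-x

  response-feasible : ∀ x → InIY x (response x)
  response-feasible x =
    unblocked , (λ v → ≤-trans (≤-reflexive (count-first m (exposed x v))) (bit≤1 _))
    where
    unblocked : ∀ v e → bit (response x v e) ≤ 1 ∸ bit (x v e)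
    unblocked v e with response x v e in r
    ... | false = z≤n
    ... | true rewrite proj₂ (response⇒exposed {x} r) = ≤-refl
    bit≤1 : ∀ b → bit b ≤ 1
    bit≤1 false = z≤n
    bit≤1 true  = ≤-refl

  response-load : ∀ x v → load (response x) v + bit (lookup (covered x) v) ≡ 1
  response-load x v = begin
    load (response x) v + bit (lookup (covered x) v)
      ≡⟨ cong₂ _+_ (load≡count (response x) v) (cong bit (lookup∘tabulate _ v)) ⟩
    count m (λ e → ⌊ incident? v e ⌋ ∧ response x v e) + bit (not any-exposed)
      ≡⟨ cong (_+ bit (not any-exposed)) (sumFin-cong m (cong bit ∘ response⊆incident)) ⟩
    count m (response x v) + bit (not any-exposed)
      ≡⟨ cong (_+ bit (not any-exposed)) (count-first m (exposed x v)) ⟩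
    bit any-exposed + bit (not any-exposed)
      ≡⟨ bit+bit-not any-exposed ⟩
    1 ∎
    where
    open ≡-Reasoning
    any-exposed : Bool
    any-exposed = anyᵇ m (exposed x v)
    response⊆incident : ∀ e → ⌊ incident? v e ⌋ ∧ response x v e ≡ response x v e
    response⊆incident e with response x v e in r
    ... | false = ∧-zeroʳ _
    ... | true  = trans (∧-identityʳ _) (proj₁ (response⇒exposed {x} r))

  stars-weight : ∀ S {y} → InIY (stars S) y → weight G y + ∣ S ∣ ≤ n
  stars-weight S {y} y∈IY = subst (_≤ n) (sym (weight+∣S∣ y S)) (sumFin≤size n (stars-load S y∈IY))

  response-weight : ∀ x → weight G (response x) + ∣ covered x ∣ ≡ n
  response-weight x = trans (weight+∣S∣ (response x) (covered x)) (sumFin≡size n (response-load x))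

theorem1 : {n m : ℕ} (G : Graph n m) (q : ℕ) →
    (Σ (Subset n) (λ S → IndependentSet G S × ∣ S ∣ ≥ q))
      ⇔ (Σ (BinVec n m) (λ x → InIX x ×
           (∀ (y : BinVec n m) → InIY x y → + (weight G y) ≤ℤ (+ n - + q))))
theorem1 {n} G q = mk⇔
  (λ (S , indep , q≤∣S∣) → stars G S , stars-feasible G indep , λ y y∈IY →
    Equivalence.from (+m≤+n-+o⇔m+o≤n (weight G y) n q)
      (≤-trans (+-monoʳ-≤ (weight G y) q≤∣S∣) (stars-weight G S y∈IY)))
  (λ (x , x∈IX , bounded) → covered G x , covered-independent G x∈IX ,
    let y = response G x in
    +-cancelˡ-≤ (weight G y) q _
      (subst (weight G y + q ≤_) (sym (response-weight G x))
        (Equivalence.to (+m≤+n-+o⇔m+o≤n (weight G y) n q) (bounded y (response-feasible G x)))))
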